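{- Let $G$ be a connected simple graph on $[N]$ with an edge $e=uv$ such that $\deg_G(u)=2$. If $c\in\mathfrak{D}(G)$, then $\alpha(c):=(c,1)\in\mathbb{Z}^{N+1}$ belongs to $\mathfrak{D}(G\mathbin{:}e)$. Moreover, $\alpha:\mathfrak{D}(G)\to\mathfrak{D}(G\mathbin{:}e)$ is injective.
   Context: Let $\mathcal{N}_G(i)$ denote the set of neighbors of $i$ in a graph $G$ on $[N]$. A sequence $(a_1,\dots,a_N)\in\mathbb{Z}_{\ge0}^N$ is $D(G)$-draconian if $\sum_i a_i=N-1$ and for every nonempty $S\subseteq[N]$, $\sum_{i\in S}a_i<\left|S\cup\bigcup_{i\in S}\mathcal{N}_G(i)\right|$; $\mathfrak{D}(G)$ is the set of such sequences. $G\mathbin{:}e$ is the graph on $[N+1]$ obtained by subdividing $e=uv$ with the new vertex $N+1$: its edge set is $(E(G)\setminus\{uv\})\cup\{u(N+1),v(N+1)\}$. -}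

module Defs where

open import Data.Nat using (ℕ; zero; suc; _+_; _∸_; _<_)
open import Data.Bool using (Bool; true; false; _∧_; _∨_; not; if_then_else_)
open import Data.Fin using (Fin; zero; suc; _≟_)
open import Data.Fin.Subset using (Subset; Nonempty; ∣_∣)
open import Data.Maybe using (Maybe; just; nothing)
import Data.Maybe as Maybe
open import Data.Vec using (Vec; lookup; tabulate; _∷ʳ_)
open import Data.Vec.Functional using () renaming (foldr to foldrF)
open import Data.List using (List; sum; map)
open import Data.List.Base using ()
open import Data.Product using (_×_; Σ)
open import Relation.Nullary.Decidable using (⌊_⌋)
open import Relation.Binary.PropositionalEquality using (_≡_)
open import Data.Fin.Base using () renaming (toℕ to toℕ)
import Data.Vec as V

Adj : ℕ → Set
Adj N = Fin N → Fin N → Bool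

record IsSimple {N : ℕ} (G : Adj N) : Set where
  field
    symm   : ∀ i j → G i j ≡ G j i
    irrefl : ∀ i → G i i ≡ false

data Reach {N : ℕ} (G : Adj N) : Fin N → Fin N → Set where
  here : ∀ {i} → Reach G i i
  step : ∀ {i j k} → G i j ≡ true → Reach G j k → Reach G i k

Connected : {N : ℕ} → Adj N → Set
Connected {N} G = ∀ (i j : Fin N) → Reach G i j

nbhd : {N : ℕ} → Adj N → Fin N → Subset N
nbhd G i = tabulate (G i)

deg : {N : ℕ} → Adj N → Fin N → ℕ
deg G i = ∣ nbhd G i ∣

anyFin : {N : ℕ} → (Fin N → Bool) → Bool
anyFin {zero}  f = false
anyFin {suc N} f = f zero ∨ anyFin (λ i → f (suc i))

closedNbhd : {N : ℕ} → Adj N → Subset N → Subset N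
closedNbhd G S = tabulate (λ j → lookup S j ∨ anyFin (λ i → lookup S i ∧ G i j))

sumOn : {N : ℕ} → Subset N → Vec ℕ N → ℕ
sumOn S a = V.sum (tabulate (λ i → if lookup S i then lookup a i else 0))

Draconian : {N : ℕ} → Adj N → Vec ℕ N → Set
Draconian {N} G a =
  (V.sum a ≡ N ∸ 1) × (∀ (S : Subset N) → Nonempty S → sumOn S a < ∣ closedNbhd G S ∣)

-- view of Fin (suc N): nothing = the new last vertex N+1, just i = old vertex i
caseLast : {N : ℕ} → Fin (suc N) → Maybe (Fin N)
caseLast {zero}  zero    = nothing
caseLast {suc N} zero    = just zero
caseLast {suc N} (suc i) = Maybe.map suc (caseLast i)

-- G : e, subdividing e = uv with new vertex N+1 (the last element of Fin (suc N))
subdivide : {N : ℕ} → Adj N → Fin N → Fin N → Adj (suc N)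
subdivide {N} G u v x y = go (caseLast x) (caseLast y)
  where
  is : Fin N → Fin N → Bool
  is i j = ⌊ i ≟ j ⌋
  go : Maybe (Fin N) → Maybe (Fin N) → Bool
  go (just i) (just j) = G i j ∧ not ((is i u ∧ is j v) ∨ (is i v ∧ is j u))
  go (just i) nothing  = is i u ∨ is i v
  go nothing  (just j) = is j u ∨ is j v
  go nothing  nothing  = false

α : {N : ℕ} → Vec ℕ N → Vec ℕ (suc N)
α c = c ∷ʳ 1

-- Write S ⊆ [N+1] as S′ ⊆ [N] plus possibly the new vertex N+1. Subdividing uv
-- only deletes the edge uv, so a vertex of N_G[S′] can leave the old part of
-- N_{G:e}[S] only if it is an endpoint of uv outside S′ whose partner lies in S′.
-- At most one vertex is lost this way, and then the partner puts N+1 into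
-- N_{G:e}[S]; hence |N_G[S′]| ≤ |N_{G:e}[S]|, which settles the case N+1 ∉ S.
-- If N+1 ∈ S, its weight 1 is paid for by N+1 itself: being adjacent to u and
-- v, it keeps N_G[S′] ∪ {u} inside the old part of N_{G:e}[S], and the
-- draconian inequality Σ_{S′} c < |N_G[S′] ∪ {u}| holds even for S′ = ∅.
module Submission where

open import Defs
open import Data.Nat using (ℕ; zero; suc; _+_; _<_; _≤_; z≤n; s≤s)
open import Data.Nat.Properties
  using (≤-reflexive; ≤-trans; +-identityʳ; +-assoc; +-comm; +-suc; n≤1+n; m≤m+n;
         +-monoʳ-≤; +-monoˡ-≤; +-monoˡ-<; module ≤-Reasoning)
open import Data.Bool using (Bool; true; false; _∧_; _∨_; if_then_else_)
open import Data.Bool.Properties using (∨-zeroʳ; ∧-conicalˡ; ∧-conicalʳ)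
open import Data.Fin using (Fin; zero; suc; inject₁; fromℕ; _≟_)
open import Data.Fin.Subset
  using (Subset; Nonempty; Empty; ∣_∣; _∈_; _∉_; _⊆_; _∪_; ⁅_⁆)
  renaming (⊥ to ∅)
open import Data.Fin.Subset.Properties
  using (_∈?_; nonempty?; Empty-unique; p⊆q⇒∣p∣≤∣q∣; ∣p∣≤∣p∪q∣; ∣q∣≤∣p∪q∣;
         x∈p∪q⁺; x∈p∪q⁻; x∈⁅x⁆; x∈⁅y⁆⇒x≡y; ∣⁅x⁆∣≡1)
open import Data.Vec using (Vec; []; _∷_; lookup; init; last; _∷ʳ_; here; there)
import Data.Vec as V
open import Data.Vec.Properties using (lookup∘tabulate; []=⇒lookup; lookup⇒[]=; ∷ʳ-injectiveˡ)
open import Data.Product using (_×_; _,_; ∃)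
open import Data.Sum using (_⊎_; inj₁; inj₂)
open import Relation.Nullary using (yes; no; contradiction)
open import Relation.Nullary.Decidable using (dec-true; isYes≗does; ⌊_⌋)
open import Data.Maybe using (just; nothing)
import Data.Maybe as Maybe
open import Relation.Binary.PropositionalEquality using (_≡_; refl; sym; trans; cong)

private
  variable
    A : Set
    n : ℕ

lookup-init : (xs : Vec A (suc n)) (i : Fin n) → lookup (init xs) i ≡ lookup xs (inject₁ i)
lookup-init (_ ∷ _ ∷ _)       zero    = refl
lookup-init (_ ∷ xs@(_ ∷ _)) (suc i) = lookup-init xs i

last≡lookup-fromℕ : (xs : Vec A (suc n)) → last xs ≡ lookup xs (fromℕ n)
last≡lookup-fromℕ (_ ∷ [])         = refl
last≡lookup-fromℕ (_ ∷ xs@(_ ∷ _)) = last≡lookup-fromℕ xs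

sum-∷ʳ : (xs : Vec ℕ n) (y : ℕ) → V.sum (xs ∷ʳ y) ≡ V.sum xs + y
sum-∷ʳ []       y = +-identityʳ y
sum-∷ʳ (x ∷ xs) y = trans (cong (x +_) (sum-∷ʳ xs y)) (sym (+-assoc x (V.sum xs) y))

module _ {p : Subset (suc n)} {i : Fin n} where

  ∈-init⁺ : inject₁ i ∈ p → i ∈ init p
  ∈-init⁺ i∈p = lookup⇒[]= i (init p) (trans (lookup-init p i) ([]=⇒lookup i∈p))

  ∈-init⁻ : i ∈ init p → inject₁ i ∈ p
  ∈-init⁻ i∈p = lookup⇒[]= (inject₁ i) p (trans (sym (lookup-init p i)) ([]=⇒lookup i∈p))

fromℕ∈⇒last : {p : Subset (suc n)} → fromℕ n ∈ p → last p ≡ true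
fromℕ∈⇒last {p = p} n∈p = trans (last≡lookup-fromℕ p) ([]=⇒lookup n∈p)

last⇒fromℕ∈ : {p : Subset (suc n)} → last p ≡ true → fromℕ n ∈ p
last⇒fromℕ∈ {n} {p} e = lookup⇒[]= (fromℕ n) p (trans (sym (last≡lookup-fromℕ p)) e)

∣p∣≡∣init∣+last : (p : Subset (suc n)) → ∣ p ∣ ≡ ∣ init p ∣ + (if last p then 1 else 0)
∣p∣≡∣init∣+last (true  ∷ [])        = refl
∣p∣≡∣init∣+last (false ∷ [])        = refl
∣p∣≡∣init∣+last (true  ∷ p@(_ ∷ _)) = cong suc (∣p∣≡∣init∣+last p)
∣p∣≡∣init∣+last (false ∷ p@(_ ∷ _)) = ∣p∣≡∣init∣+last p

nonempty-init⊎last : (p : Subset (suc n)) → Nonempty p → Nonempty (init p) ⊎ last p ≡ true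
nonempty-init⊎last (_ ∷ [])         (zero , x∈p)            = inj₂ ([]=⇒lookup x∈p)
nonempty-init⊎last (_ ∷ _ ∷ _)      (zero , here)           = inj₁ (zero , here)
nonempty-init⊎last (_ ∷ p@(_ ∷ _)) (suc x , there x∈p) with nonempty-init⊎last p (x , x∈p)
... | inj₁ (i , i∈p) = inj₁ (suc i , there i∈p)
... | inj₂ e         = inj₂ e

∣p∪q∣≤∣p∣+∣q∣ : (p q : Subset n) → ∣ p ∪ q ∣ ≤ ∣ p ∣ + ∣ q ∣
∣p∪q∣≤∣p∣+∣q∣ []          []          = z≤n
∣p∪q∣≤∣p∣+∣q∣ (true ∷ p)  (true ∷ q)  = s≤s (≤-trans (∣p∪q∣≤∣p∣+∣q∣ p q) (+-monoʳ-≤ ∣ p ∣ (n≤1+n ∣ q ∣)))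
∣p∪q∣≤∣p∣+∣q∣ (true ∷ p)  (false ∷ q) = s≤s (∣p∪q∣≤∣p∣+∣q∣ p q)
∣p∪q∣≤∣p∣+∣q∣ (false ∷ p) (true ∷ q)  rewrite +-suc ∣ p ∣ ∣ q ∣ = s≤s (∣p∪q∣≤∣p∣+∣q∣ p q)
∣p∪q∣≤∣p∣+∣q∣ (false ∷ p) (false ∷ q) = ∣p∪q∣≤∣p∣+∣q∣ p q

sumOn-∷ʳ : (S : Subset (suc n)) (c : Vec ℕ n) (x : ℕ) →
           sumOn S (c ∷ʳ x) ≡ sumOn (init S) c + (if last S then x else 0)
sumOn-∷ʳ (true  ∷ [])        []      x = +-identityʳ x
sumOn-∷ʳ (false ∷ [])        []      x = refl
sumOn-∷ʳ (s ∷ S@(_ ∷ _))    (a ∷ c) x = trans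
  (cong ((if s then a else 0) +_) (sumOn-∷ʳ S c x))
  (sym (+-assoc (if s then a else 0) (sumOn (init S) c) _))

sumOn-∅ : (c : Vec ℕ n) → sumOn ∅ c ≡ 0
sumOn-∅ []      = refl
sumOn-∅ (_ ∷ c) = sumOn-∅ c

sumOn-empty : {S : Subset n} (c : Vec ℕ n) → Empty S → sumOn S c ≡ 0
sumOn-empty c S-empty rewrite Empty-unique S-empty = sumOn-∅ c

anyFin-intro : (f : Fin n → Bool) (i : Fin n) → f i ≡ true → anyFin f ≡ true
anyFin-intro f zero    fi = cong (_∨ anyFin (λ k → f (suc k))) fi
anyFin-intro f (suc i) fi =
  trans (cong (f zero ∨_) (anyFin-intro (λ k → f (suc k)) i fi)) (∨-zeroʳ (f zero))

anyFin-elim : (f : Fin n → Bool) → anyFin f ≡ true → ∃ λ i → f i ≡ true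
anyFin-elim {suc n} f any with f zero in f0
... | true  = zero , f0
... | false with anyFin-elim (λ k → f (suc k)) any
...   | i , fi = suc i , fi

module _ {N : ℕ} (G : Adj N) (S : Subset N) where

  private
    hasNbrInS : Fin N → Bool
    hasNbrInS j = anyFin (λ i → lookup S i ∧ G i j)

  lookup-closedNbhd : ∀ j → lookup (closedNbhd G S) j ≡ (lookup S j ∨ hasNbrInS j)
  lookup-closedNbhd j = lookup∘tabulate _ j

  ⊆-closedNbhd : S ⊆ closedNbhd G S
  ⊆-closedNbhd {j} j∈S = lookup⇒[]= j (closedNbhd G S)
    (trans (lookup-closedNbhd j) (cong (_∨ hasNbrInS j) ([]=⇒lookup j∈S)))

  nbr∈closedNbhd : ∀ {i j} → i ∈ S → G i j ≡ true → j ∈ closedNbhd G S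
  nbr∈closedNbhd {i} {j} i∈S Gij = lookup⇒[]= j (closedNbhd G S)
    (trans (lookup-closedNbhd j) (trans (cong (lookup S j ∨_) any) (∨-zeroʳ (lookup S j))))
    where
    any : hasNbrInS j ≡ true
    any = anyFin-intro _ i (trans (cong (_∧ G i j) ([]=⇒lookup i∈S)) Gij)

  closedNbhd⁻ : ∀ {j} → j ∈ closedNbhd G S → j ∈ S ⊎ ∃ λ i → i ∈ S × G i j ≡ true
  closedNbhd⁻ {j} j∈N with lookup S j in Sj
  ... | true  = inj₁ (lookup⇒[]= j S Sj)
  ... | false with anyFin-elim _ (trans (cong (_∨ hasNbrInS j) (sym Sj))
                                      (trans (sym (lookup-closedNbhd j)) ([]=⇒lookup j∈N)))
  ...   | i , SiGij = inj₂ (i , lookup⇒[]= i S (∧-conicalˡ _ _ SiGij) , ∧-conicalʳ _ _ SiGij)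

draconian-bound : ∀ {N} (G : Adj N) (c : Vec ℕ N) → Draconian G c →
                  ∀ (S : Subset N) x → sumOn S c < ∣ closedNbhd G S ∪ ⁅ x ⁆ ∣
draconian-bound G c (_ , bound) S x with nonempty? S
... | yes S≢∅ = ≤-trans (bound S S≢∅) (∣p∣≤∣p∪q∣ (closedNbhd G S) ⁅ x ⁆)
... | no  S≡∅ rewrite sumOn-empty c S≡∅ =
  ≤-trans (≤-reflexive (sym (∣⁅x⁆∣≡1 x))) (∣q∣≤∣p∪q∣ (closedNbhd G S) ⁅ x ⁆)

caseLast-inject₁ : (i : Fin n) → caseLast (inject₁ i) ≡ just i
caseLast-inject₁ {suc n} zero    = refl
caseLast-inject₁ {suc n} (suc i) = cong (Maybe.map suc) (caseLast-inject₁ i)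

caseLast-fromℕ : ∀ n → caseLast (fromℕ n) ≡ nothing
caseLast-fromℕ zero    = refl
caseLast-fromℕ (suc n) = cong (Maybe.map suc) (caseLast-fromℕ n)

⌊≟⌋-refl : (i : Fin n) → ⌊ i ≟ i ⌋ ≡ true
⌊≟⌋-refl i = trans (isYes≗does (i ≟ i)) (dec-true (i ≟ i) refl)

module _ {N : ℕ} (G : Adj N) (u v : Fin N) where

  private
    H : Adj (suc N)
    H = subdivide G u v

  subdivide-preserves-edge : ∀ {i j} → G i j ≡ true →
    H (inject₁ i) (inject₁ j) ≡ true ⊎ (i ≡ u × j ≡ v) ⊎ (i ≡ v × j ≡ u)
  subdivide-preserves-edge {i} {j} Gij
    rewrite caseLast-inject₁ i | caseLast-inject₁ j | Gij
    with i ≟ u | j ≟ v | i ≟ v | j ≟ u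
  ... | yes i≡u | yes j≡v | _       | _       = inj₂ (inj₁ (i≡u , j≡v))
  ... | _       | _       | yes i≡v | yes j≡u = inj₂ (inj₂ (i≡v , j≡u))
  ... | no _    | _       | no _    | _       = inj₁ refl
  ... | no _    | _       | yes _   | no _    = inj₁ refl
  ... | yes _   | no _    | no _    | _       = inj₁ refl
  ... | yes _   | no _    | yes _   | no _    = inj₁ refl

  subdivide-endpoint-new : ∀ {k} → k ≡ u ⊎ k ≡ v → H (inject₁ k) (fromℕ N) ≡ true
  subdivide-endpoint-new {k} k∈uv rewrite caseLast-inject₁ k | caseLast-fromℕ N with k∈uv
  ... | inj₁ refl = cong (_∨ ⌊ k ≟ v ⌋) (⌊≟⌋-refl k)
  ... | inj₂ refl = trans (cong (⌊ k ≟ u ⌋ ∨_) (⌊≟⌋-refl k)) (∨-zeroʳ _)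

  subdivide-new-endpoint : ∀ {k} → k ≡ u ⊎ k ≡ v → H (fromℕ N) (inject₁ k) ≡ true
  subdivide-new-endpoint {k} k∈uv rewrite caseLast-inject₁ k | caseLast-fromℕ N with k∈uv
  ... | inj₁ refl = cong (_∨ ⌊ k ≟ v ⌋) (⌊≟⌋-refl k)
  ... | inj₂ refl = trans (cong (⌊ k ≟ u ⌋ ∨_) (⌊≟⌋-refl k)) (∨-zeroʳ _)

  module _ (S : Subset (suc N)) where

    private
      T : Subset (suc N)
      T = closedNbhd H S

    -- An endpoint of uv outside S′ that N_G[S′] may have reached only through uv.
    Lost : Fin N → Set
    Lost j = j ∉ init S × (j ≡ u × v ∈ init S ⊎ j ≡ v × u ∈ init S)

    closedNbhd-subdivide : ∀ {j} → j ∈ closedNbhd G (init S) → j ∈ init T ⊎ Lost j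
    closedNbhd-subdivide {j} j∈N with j ∈? init S
    ... | yes j∈S = inj₁ (∈-init⁺ (⊆-closedNbhd H S (∈-init⁻ j∈S)))
    ... | no  j∉S with closedNbhd⁻ G (init S) j∈N
    ...   | inj₁ j∈S = contradiction j∈S j∉S
    ...   | inj₂ (i , i∈S , Gij) with subdivide-preserves-edge Gij
    ...     | inj₁ Hij                 = inj₁ (∈-init⁺ (nbr∈closedNbhd H S (∈-init⁻ i∈S) Hij))
    ...     | inj₂ (inj₁ (refl , refl)) = inj₂ (j∉S , inj₂ (refl , i∈S))
    ...     | inj₂ (inj₂ (refl , refl)) = inj₂ (j∉S , inj₁ (refl , i∈S))

    lost⇒last : ∀ {j} → Lost j → last T ≡ true
    lost⇒last (_ , inj₁ (_ , v∈S)) =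
      fromℕ∈⇒last (nbr∈closedNbhd H S (∈-init⁻ v∈S) (subdivide-endpoint-new (inj₂ refl)))
    lost⇒last (_ , inj₂ (_ , u∈S)) =
      fromℕ∈⇒last (nbr∈closedNbhd H S (∈-init⁻ u∈S) (subdivide-endpoint-new (inj₁ refl)))

    lost-unique : ∃ λ w → ∀ {j} → Lost j → j ≡ w
    lost-unique with u ∈? init S
    ... | yes u∈S = v , λ { (_ , inj₂ (j≡v , _)) → j≡v
                          ; (j∉S , inj₁ (refl , _)) → contradiction u∈S j∉S }
    ... | no  u∉S = u , λ { (_ , inj₁ (j≡u , _)) → j≡u
                          ; (_ , inj₂ (_ , u∈S)) → contradiction u∈S u∉S }

    ∣closedNbhd∣≤∣closedNbhd-subdivide∣ : ∣ closedNbhd G (init S) ∣ ≤ ∣ T ∣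
    ∣closedNbhd∣≤∣closedNbhd-subdivide∣ =
      ≤-trans bound (≤-reflexive (sym (∣p∣≡∣init∣+last T)))
      where
      bound : ∣ closedNbhd G (init S) ∣ ≤ ∣ init T ∣ + (if last T then 1 else 0)
      bound with last T in lastT
      ... | false = ≤-trans (p⊆q⇒∣p∣≤∣q∣ ⊆init) (m≤m+n ∣ init T ∣ 0)
        where
        ⊆init : closedNbhd G (init S) ⊆ init T
        ⊆init j∈N with closedNbhd-subdivide j∈N
        ... | inj₁ j∈T  = j∈T
        ... | inj₂ lost = contradiction (trans (sym lastT) (lost⇒last lost)) λ ()
      ... | true with lost-unique
      ...   | w , lost⇒w = begin
        ∣ closedNbhd G (init S) ∣ ≤⟨ p⊆q⇒∣p∣≤∣q∣ ⊆init∪w ⟩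
        ∣ init T ∪ ⁅ w ⁆ ∣        ≤⟨ ∣p∪q∣≤∣p∣+∣q∣ (init T) ⁅ w ⁆ ⟩
        ∣ init T ∣ + ∣ ⁅ w ⁆ ∣    ≡⟨ cong (∣ init T ∣ +_) (∣⁅x⁆∣≡1 w) ⟩
        ∣ init T ∣ + 1            ∎
        where
        open ≤-Reasoning
        ⊆init∪w : closedNbhd G (init S) ⊆ init T ∪ ⁅ w ⁆
        ⊆init∪w j∈N with closedNbhd-subdivide j∈N
        ... | inj₁ j∈T  = x∈p∪q⁺ (inj₁ j∈T)
        ... | inj₂ lost rewrite lost⇒w lost = x∈p∪q⁺ (inj₂ (x∈⁅x⁆ w))

    module _ (new∈S : last S ≡ true) where

      ∣closedNbhd-subdivide∣≡∣init∣+1 : ∣ T ∣ ≡ ∣ init T ∣ + 1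
      ∣closedNbhd-subdivide∣≡∣init∣+1 = trans (∣p∣≡∣init∣+last T)
        (cong (λ b → ∣ init T ∣ + (if b then 1 else 0))
              (fromℕ∈⇒last (⊆-closedNbhd H S (last⇒fromℕ∈ new∈S))))

      endpoint∈closedNbhd : ∀ {j} → j ≡ u ⊎ j ≡ v → j ∈ init T
      endpoint∈closedNbhd j∈uv =
        ∈-init⁺ (nbr∈closedNbhd H S (last⇒fromℕ∈ new∈S) (subdivide-new-endpoint j∈uv))

      closedNbhd∪⁅u⁆⊆init : closedNbhd G (init S) ∪ ⁅ u ⁆ ⊆ init T
      closedNbhd∪⁅u⁆⊆init {j} j∈N∪u with x∈p∪q⁻ (closedNbhd G (init S)) ⁅ u ⁆ j∈N∪u
      ... | inj₂ j∈u = endpoint∈closedNbhd (inj₁ (x∈⁅y⁆⇒x≡y u j∈u))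
      ... | inj₁ j∈N with closedNbhd-subdivide j∈N
      ...   | inj₁ j∈T                   = j∈T
      ...   | inj₂ (_ , inj₁ (j≡u , _)) = endpoint∈closedNbhd (inj₁ j≡u)
      ...   | inj₂ (_ , inj₂ (j≡v , _)) = endpoint∈closedNbhd (inj₂ j≡v)

α-draconian : ∀ {n} (G : Adj (suc n)) (u v : Fin (suc n)) (c : Vec ℕ (suc n)) →
              Draconian G c → Draconian (subdivide G u v) (α c)
α-draconian {n} G u v c d@(sum≡ , bound) = sum-α , closed
  where
  open ≤-Reasoning
  H = subdivide G u v

  sum-α : V.sum (c ∷ʳ 1) ≡ suc n
  sum-α = trans (sum-∷ʳ c 1) (trans (cong (_+ 1) sum≡) (+-comm n 1))

  closed : ∀ S → Nonempty S → sumOn S (c ∷ʳ 1) < ∣ closedNbhd H S ∣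
  closed S S≢∅ rewrite sumOn-∷ʳ S c 1 with last S in lastS
  ... | false with nonempty-init⊎last S S≢∅
  ...   | inj₂ new∈S = contradiction (trans (sym lastS) new∈S) λ ()
  ...   | inj₁ S′≢∅ = begin-strict
    sumOn (init S) c + 0           ≡⟨ +-identityʳ _ ⟩
    sumOn (init S) c               <⟨ bound (init S) S′≢∅ ⟩
    ∣ closedNbhd G (init S) ∣      ≤⟨ ∣closedNbhd∣≤∣closedNbhd-subdivide∣ G u v S ⟩
    ∣ closedNbhd H S ∣             ∎
  closed S S≢∅ | true = begin-strict
    sumOn (init S) c + 1
      <⟨ +-monoˡ-< 1 (draconian-bound G c d (init S) u) ⟩
    ∣ closedNbhd G (init S) ∪ ⁅ u ⁆ ∣ + 1
      ≤⟨ +-monoˡ-≤ 1 (p⊆q⇒∣p∣≤∣q∣ (closedNbhd∪⁅u⁆⊆init G u v S lastS)) ⟩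
    ∣ init (closedNbhd H S) ∣ + 1
      ≡⟨ sym (∣closedNbhd-subdivide∣≡∣init∣+1 G u v S lastS) ⟩
    ∣ closedNbhd H S ∣ ∎

lemma3p6 : (N : ℕ) (G : Adj N) → IsSimple G → Connected G →
    (u v : Fin N) → G u v ≡ true → deg G u ≡ 2 →
    ((c : Vec ℕ N) → Draconian G c → Draconian (subdivide G u v) (α c))
    × ((c c′ : Vec ℕ N) → Draconian G c → Draconian G c′ → α c ≡ α c′ → c ≡ c′)
lemma3p6 (suc n) G _ _ u v _ _ =
  α-draconian G u v , λ c c′ _ _ → ∷ʳ-injectiveˡ c c′
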